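{- Let $G$ be a graph on $n$ vertices with degree sequence $d_1\le d_2\le\dots\le d_n$, and let $\tau$ be any threshold assignment for $G$ with average threshold $\bar t=\sum_v\tau(v)/n$. Then $$dyn_\tau(G)\le \max\Big\{k\in\{0,\dots,n\}: \sum_{i=1}^k(d_i+1)\le n\bar t\Big\}.$$ Consequently $Dyn_{\bar t=t}(G)\le \max\{k: \sum_{i=1}^k(d_i+1)\le nt\}$.
   Context: Graphs are finite, undirected, simple. A threshold assignment for $G$ is a function $\tau:V(G)\to\mathbb{N}\cup\{0\}$ with $\tau(v)\le \deg(v)$ for every $v$. For $M\subseteq V(G)$, the $\tau$-dynamic process starting from $M$ is $D_0=M$ and, for $i\ge0$, $D_{i+1}$ = set of vertices $v\notin D_0\cup\dots\cup D_i$ with at least $\tau(v)$ neighbours in $D_0\cup\dots\cup D_i$; $M$ is a $\tau$-dynamic monopoly if $\bigcup_i D_i=V(G)$. $dyn_\tau(G)$ is the minimum size of a $\tau$-dynamic monopoly, and $Dyn_{\bar t=t}(G)$ is the maximum of $dyn_\tau(G)$ over threshold assignments with average threshold $t$. -}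

module Defs where

open import Data.Nat using (ℕ; zero; suc; _+_; _≤_; _≤ᵇ_; _<?_)
open import Data.Bool using (Bool; true; false; _∨_; _∧_; if_then_else_)
open import Data.Fin using (Fin; zero; suc; fromℕ<) renaming (_≤_ to _≤F_)
open import Data.Fin.Permutation using (Permutation′; _⟨$⟩ʳ_)
open import Data.Product using (∃; _×_)
open import Relation.Nullary using (yes; no)
open import Relation.Binary.PropositionalEquality using (_≡_)

sumF : ∀ {n} → (Fin n → ℕ) → ℕ
sumF {zero}  f = 0
sumF {suc n} f = f zero + sumF (λ i → f (suc i))

count : ∀ {n} → (Fin n → Bool) → ℕ
count P = sumF (λ i → if P i then 1 else 0)

record Graph (n : ℕ) : Set where
  field
    adj    : Fin n → Fin n → Bool
    sym    : ∀ u v → adj u v ≡ adj v u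
    irrefl : ∀ v → adj v v ≡ false
open Graph public

deg : ∀ {n} → Graph n → Fin n → ℕ
deg G v = count (adj G v)

nbrsIn : ∀ {n} → Graph n → (Fin n → Bool) → Fin n → ℕ
nbrsIn G S v = count (λ u → adj G v u ∧ S u)

IsThreshold : ∀ {n} → Graph n → (Fin n → ℕ) → Set
IsThreshold G τ = ∀ v → τ v ≤ deg G v

-- Cumulative activated set D_0 ∪ … ∪ D_i of the τ-dynamic process from M.
active : ∀ {n} → Graph n → (Fin n → ℕ) → (Fin n → Bool) → ℕ → Fin n → Bool
active G τ M zero    v = M v
active G τ M (suc i) v = active G τ M i v ∨ (τ v ≤ᵇ nbrsIn G (active G τ M i) v)

IsDynMonopoly : ∀ {n} → Graph n → (Fin n → ℕ) → (Fin n → Bool) → Set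
IsDynMonopoly G τ M = ∀ v → ∃ λ i → active G τ M i v ≡ true

-- dyn_τ(G) ≤ k : some τ-dynamic monopoly has size ≤ k.
DynLe : ∀ {n} → Graph n → (Fin n → ℕ) → ℕ → Set
DynLe G τ k = ∃ λ M → IsDynMonopoly G τ M × count M ≤ k

-- Prefix sum Σ_{i=1}^k (d_i + 1) of a sequence d (0-indexed: d 0 … d (k-1)).
prefix : (ℕ → ℕ) → ℕ → ℕ
prefix d zero    = 0
prefix d (suc k) = prefix d k + (d k + 1)

-- Largest k ∈ {0,…,m} with P k = true (0 if none).
maxSat : (ℕ → Bool) → ℕ → ℕ
maxSat P zero    = 0
maxSat P (suc m) = if P (suc m) then suc m else maxSat P m

bound : (ℕ → ℕ) → ℕ → ℕ → ℕ
bound d n T = maxSat (λ k → prefix d k ≤ᵇ T) n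

-- Degree sequence listed in the order given by a permutation σ (as ℕ-indexed; 0 beyond n).
degSeq : ∀ {n} → Graph n → Permutation′ n → ℕ → ℕ
degSeq {n} G σ k with k <? n
... | yes k<n = deg G (σ ⟨$⟩ʳ fromℕ< k<n)
... | no _ = 0

Sorts : ∀ {n} → Graph n → Permutation′ n → Set
Sorts {n} G σ = ∀ (i j : Fin n) → i ≤F j → deg G (σ ⟨$⟩ʳ i) ≤ deg G (σ ⟨$⟩ʳ j)

-- Order the vertices uniformly at random and seed v iff fewer than τ v of its neighbours precede
-- it; every other vertex is then activated by the neighbours before it, in order. Vertex v is
-- seeded with probability min(τ v, d v + 1) / (d v + 1), so, as τ v ≤ d v, the seeds have expected
-- total weight Σ_{v seeded} (d v + 1) = Σ τ v = n t̄. A seed set M of weight at most n t̄ has at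
-- most as many vertices as the longest prefix of d₁ + 1 ≤ d₂ + 1 ≤ … whose sum is at most n t̄.
--
-- The expectation is derandomised by fixing the order from its last vertex backwards. Scaled by
-- K = (n + 1)!, the expected weight of the seeds chosen inside a vertex set R (with degrees taken
-- in R) is an integer potential, and it equals the average over v ∈ R of the cost of v when it
-- comes last plus the potential of R − v, so some v does no worse than the average.

module Submission where

open import Defs hiding (sym)
open import Data.Nat hiding (_≟_)
open import Data.Nat.Properties hiding (_≟_)
open import Data.Nat.Divisibility using (m≤n⇒m!∣n!; ∣-trans; m∣m*n)
open import Data.Nat.DivMod using (m*[n/m]≡n)
open import Data.Bool using (Bool; true; false; _∨_; _∧_; not; if_then_else_)
open import Data.Bool.Properties using (∧-identityʳ; ∨-zeroʳ; T-≡; if-float) renaming (_≟_ to _≟ᵇ_)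
open import Data.Fin using (Fin; zero; suc; fromℕ<; toℕ) renaming (_≤_ to _≤F_)
open import Data.Fin.Properties using (_≟_; any?; toℕ<n; fromℕ<-toℕ; fromℕ<-cong; toℕ-fromℕ<)
open import Data.Fin.Permutation using (Permutation′; _⟨$⟩ʳ_)
open import Data.Product using (∃; _×_; _,_)
open import Data.Sum using (_⊎_; inj₁; inj₂)
open import Function.Bundles using (Equivalence)
open import Relation.Nullary.Decidable using (dec-true)
open import Relation.Binary.PropositionalEquality
open import Relation.Nullary using (yes; no; does; contradiction; _×-dec_; ofʸ; ofⁿ)
import Algebra.Properties.Semiring.Sum +-*-semiring as Σ
open import Algebra.Properties.CommutativeSemigroup *-commutativeSemigroup using (x∙yz≈y∙xz)

private variable n : ℕ

infixr 8 _⊙_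
_⊙_ : Bool → ℕ → ℕ
b ⊙ x = if b then x else 0

sumF≡sum : ∀ (f : Fin n → ℕ) → sumF f ≡ Σ.sum f
sumF≡sum {zero}  f = refl
sumF≡sum {suc n} f = cong (f zero +_) (sumF≡sum (λ i → f (suc i)))

sumF-cong : ∀ {f g : Fin n → ℕ} → (∀ i → f i ≡ g i) → sumF f ≡ sumF g
sumF-cong {zero}  f≗g = refl
sumF-cong {suc n} f≗g = cong₂ _+_ (f≗g zero) (sumF-cong (λ i → f≗g (suc i)))

sumF-mono-≤ : ∀ {f g : Fin n → ℕ} → (∀ i → f i ≤ g i) → sumF f ≤ sumF g
sumF-mono-≤ {zero}  f≤g = z≤n
sumF-mono-≤ {suc n} f≤g = +-mono-≤ (f≤g zero) (sumF-mono-≤ (λ i → f≤g (suc i)))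

sumF-distrib-+ : ∀ (f g : Fin n → ℕ) → sumF (λ i → f i + g i) ≡ sumF f + sumF g
sumF-distrib-+ f g = begin
  sumF (λ i → f i + g i)  ≡⟨ sumF≡sum (λ i → f i + g i) ⟩
  Σ.sum (λ i → f i + g i) ≡⟨ Σ.∑-distrib-+ f g ⟩
  Σ.sum f + Σ.sum g       ≡⟨ sym (cong₂ _+_ (sumF≡sum f) (sumF≡sum g)) ⟩
  sumF f + sumF g         ∎
  where open ≡-Reasoning

*-distribˡ-sumF : ∀ c (f : Fin n → ℕ) → c * sumF f ≡ sumF (λ i → c * f i)
*-distribˡ-sumF c f = begin
  c * sumF f              ≡⟨ cong (c *_) (sumF≡sum f) ⟩
  c * Σ.sum f             ≡⟨ Σ.*-distribˡ-sum c f ⟩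
  Σ.sum (λ i → c * f i)   ≡⟨ sym (sumF≡sum (λ i → c * f i)) ⟩
  sumF (λ i → c * f i)    ∎
  where open ≡-Reasoning

sumF-comm : ∀ {m} (f : Fin m → Fin n → ℕ) →
            sumF (λ i → sumF (f i)) ≡ sumF (λ j → sumF (λ i → f i j))
sumF-comm f = begin
  sumF (λ i → sumF (f i))              ≡⟨ sumF-cong (λ i → sumF≡sum (f i)) ⟩
  sumF (λ i → Σ.sum (f i))             ≡⟨ sumF≡sum (λ i → Σ.sum (f i)) ⟩
  Σ.sum (λ i → Σ.sum (f i))            ≡⟨ Σ.∑-comm f ⟩
  Σ.sum (λ j → Σ.sum (λ i → f i j))    ≡⟨ sumF≡sum (λ j → Σ.sum (λ i → f i j)) ⟨
  sumF (λ j → Σ.sum (λ i → f i j))     ≡⟨ sumF-cong (λ j → sumF≡sum (λ i → f i j)) ⟨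
  sumF (λ j → sumF (λ i → f i j))      ∎
  where open ≡-Reasoning

sumF-permute : ∀ (f : Fin n → ℕ) (σ : Permutation′ n) → sumF f ≡ sumF (λ i → f (σ ⟨$⟩ʳ i))
sumF-permute f σ = begin
  sumF f                          ≡⟨ sumF≡sum f ⟩
  Σ.sum f                         ≡⟨ Σ.sum-permute f σ ⟩
  Σ.sum (λ i → f (σ ⟨$⟩ʳ i))      ≡⟨ sym (sumF≡sum (λ i → f (σ ⟨$⟩ʳ i))) ⟩
  sumF (λ i → f (σ ⟨$⟩ʳ i))       ∎
  where open ≡-Reasoning

sumF-zero : sumF {n} (λ _ → 0) ≡ 0
sumF-zero {zero}  = refl
sumF-zero {suc n} = sumF-zero {n}

⊙-sumF : ∀ b (f : Fin n → ℕ) → b ⊙ sumF f ≡ sumF (λ i → b ⊙ f i)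
⊙-sumF     true  f = refl
⊙-sumF {n} false f = sym (sumF-zero {n})

⊙-distrib-+ : ∀ b x y → b ⊙ (x + y) ≡ b ⊙ x + b ⊙ y
⊙-distrib-+ true  x y = refl
⊙-distrib-+ false x y = refl

*-⊙ : ∀ c b x → c * (b ⊙ x) ≡ b ⊙ (c * x)
*-⊙ c true  x = refl
*-⊙ c false x = *-zeroʳ c

⊙-∧ : ∀ a b x → (a ∧ b) ⊙ x ≡ b ⊙ a ⊙ x
⊙-∧ true  b     x = refl
⊙-∧ false true  x = refl
⊙-∧ false false x = refl

⊙-if : ∀ a b x y → b ⊙ (if a then x else y) ≡ (a ∧ b) ⊙ x + (not a ∧ b) ⊙ y
⊙-if true  true  x y = sym (+-identityʳ x)
⊙-if true  false x y = refl
⊙-if false true  x y = refl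
⊙-if false false x y = refl

⊙-∨-≤ : ∀ a b x → (a ∨ b) ⊙ x ≤ a ⊙ x + b ⊙ x
⊙-∨-≤ true  b     x = m≤m+n x (b ⊙ x)
⊙-∨-≤ false true  x = ≤-refl
⊙-∨-≤ false false x = z≤n


⊓-suc : ∀ t d → (d <ᵇ t) ⊙ 1 + t ⊓ d ≡ t ⊓ suc d
⊓-suc t d with d <ᵇ t | <ᵇ-reflects-< d t
... | true  | ofʸ d<t = trans (cong suc (m≥n⇒m⊓n≡n (<⇒≤ d<t))) (sym (m≥n⇒m⊓n≡n d<t))
... | false | ofⁿ d≮t = trans (m≤n⇒m⊓n≡m t≤d) (sym (m≤n⇒m⊓n≡m (m≤n⇒m≤1+n t≤d)))
  where t≤d = ≮⇒≥ d≮t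

infix 4 _⊆_
infixl 6 _─_ _∪｛_｝

_⊆_ : (Fin n → Bool) → (Fin n → Bool) → Set
S ⊆ S′ = ∀ u → S u ≡ true → S′ u ≡ true

_─_ : (Fin n → Bool) → Fin n → Fin n → Bool
(R ─ v) u = R u ∧ not (does (u ≟ v))

_∪｛_｝ : (Fin n → Bool) → Fin n → Fin n → Bool
(R ∪｛ v ｝) u = R u ∨ does (u ≟ v)

─⊆ : ∀ (R : Fin n → Bool) v → R ─ v ⊆ R
─⊆ R v u Ru-v with R u
... | true = refl

∈⇒≡⊎∈─ : ∀ (R : Fin n → Bool) u v → R u ≡ true → u ≡ v ⊎ (R ─ v) u ≡ true
∈⇒≡⊎∈─ R u v Ru with u ≟ v
... | yes u≡v = inj₁ u≡v
... | no  _   = inj₂ (trans (∧-identityʳ (R u)) Ru)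

sumF-singleton : ∀ (f : Fin n → ℕ) v → sumF (λ u → does (u ≟ v) ⊙ f u) ≡ f v
sumF-singleton {suc n} f zero = trans (cong (f zero +_) (sumF-zero {n})) (+-identityʳ (f zero))
sumF-singleton f (suc v) = sumF-singleton (λ u → f (suc u)) v

sumF-remove : ∀ {R : Fin n → Bool} {v} (f : Fin n → ℕ) → R v ≡ true →
              sumF (λ u → R u ⊙ f u) ≡ f v + sumF (λ u → (R ─ v) u ⊙ f u)
sumF-remove {R = R} {v} f Rv = begin
  sumF (λ u → R u ⊙ f u)
    ≡⟨ sumF-cong split ⟩
  sumF (λ u → does (u ≟ v) ⊙ f u + (R ─ v) u ⊙ f u)
    ≡⟨ sumF-distrib-+ (λ u → does (u ≟ v) ⊙ f u) (λ u → (R ─ v) u ⊙ f u) ⟩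
  sumF (λ u → does (u ≟ v) ⊙ f u) + sumF (λ u → (R ─ v) u ⊙ f u)
    ≡⟨ cong (_+ sumF (λ u → (R ─ v) u ⊙ f u)) (sumF-singleton f v) ⟩
  f v + sumF (λ u → (R ─ v) u ⊙ f u) ∎
  where
  open ≡-Reasoning
  split : ∀ u → R u ⊙ f u ≡ does (u ≟ v) ⊙ f u + (R ─ v) u ⊙ f u
  split u with u ≟ v
  ... | yes refl rewrite Rv = sym (+-identityʳ (f u))
  ... | no  _    rewrite ∧-identityʳ (R u) = refl

sumF-∪-≤ : ∀ (M : Fin n → Bool) v (f : Fin n → ℕ) →
           sumF (λ u → (M ∪｛ v ｝) u ⊙ f u) ≤ sumF (λ u → M u ⊙ f u) + f v
sumF-∪-≤ M v f = begin
  sumF (λ u → (M ∪｛ v ｝) u ⊙ f u)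
    ≤⟨ sumF-mono-≤ (λ u → ⊙-∨-≤ (M u) (does (u ≟ v)) (f u)) ⟩
  sumF (λ u → M u ⊙ f u + does (u ≟ v) ⊙ f u)
    ≡⟨ sumF-distrib-+ (λ u → M u ⊙ f u) (λ u → does (u ≟ v) ⊙ f u) ⟩
  sumF (λ u → M u ⊙ f u) + sumF (λ u → does (u ≟ v) ⊙ f u)
    ≡⟨ cong (sumF (λ u → M u ⊙ f u) +_) (sumF-singleton f v) ⟩
  sumF (λ u → M u ⊙ f u) + f v ∎
  where open ≤-Reasoning

∈─-comm : ∀ (R : Fin n → Bool) u v x → R v ⊙ (R ─ v) u ⊙ x ≡ R u ⊙ (R ─ u) v ⊙ x
∈─-comm R u v x with u ≟ v | v ≟ u
... | yes refl | yes _    = refl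
... | yes refl | no  u≢u  = contradiction refl u≢u
... | no  u≢v  | yes refl = contradiction refl u≢v
... | no  _    | no  _    with R u | R v
...   | true  | true  = refl
...   | true  | false = refl
...   | false | true  = refl
...   | false | false = refl

count-─ : ∀ (R : Fin n → Bool) {v} → R v ≡ true → count R ≡ suc (count (R ─ v))
count-─ R = sumF-remove {R = R} (λ _ → 1)

count-≤ : ∀ (P : Fin n → Bool) → count P ≤ n
count-≤ {zero}  P = z≤n
count-≤ {suc n} P with P zero
... | true  = s≤s (count-≤ (λ i → P (suc i)))
... | false = m≤n⇒m≤1+n (count-≤ (λ i → P (suc i)))

count-mono-⊆ : ∀ {P Q : Fin n → Bool} → P ⊆ Q → count P ≤ count Q
count-mono-⊆ {P = P} {Q} P⊆Q = sumF-mono-≤ pointwise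
  where
  pointwise : ∀ i → P i ⊙ 1 ≤ Q i ⊙ 1
  pointwise i with P i | P⊆Q i
  ... | true  | Qi = ≤-reflexive (cong (_⊙ 1) (sym (Qi refl)))
  ... | false | _  = z≤n

sumF-⊙-const : ∀ (P : Fin n → Bool) c → sumF (λ i → P i ⊙ c) ≡ count P * c
sumF-⊙-const {zero}  P c = refl
sumF-⊙-const {suc n} P c with P zero
... | true  = cong (c +_) (sumF-⊙-const (λ i → P (suc i)) c)
... | false = sumF-⊙-const (λ i → P (suc i)) c

sumF-⊙-if : ∀ (A S : Fin n → Bool) x y →
            sumF (λ i → S i ⊙ (if A i then x else y))
              ≡ count (λ i → A i ∧ S i) * x + count (λ i → not (A i) ∧ S i) * y
sumF-⊙-if A S x y = begin
  sumF (λ i → S i ⊙ (if A i then x else y))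
    ≡⟨ sumF-cong (λ i → ⊙-if (A i) (S i) x y) ⟩
  sumF (λ i → (A i ∧ S i) ⊙ x + (not (A i) ∧ S i) ⊙ y)
    ≡⟨ sumF-distrib-+ (λ i → (A i ∧ S i) ⊙ x) (λ i → (not (A i) ∧ S i) ⊙ y) ⟩
  sumF (λ i → (A i ∧ S i) ⊙ x) + sumF (λ i → (not (A i) ∧ S i) ⊙ y)
    ≡⟨ cong₂ _+_ (sumF-⊙-const (λ i → A i ∧ S i) x) (sumF-⊙-const (λ i → not (A i) ∧ S i) y) ⟩
  count (λ i → A i ∧ S i) * x + count (λ i → not (A i) ∧ S i) * y ∎
  where open ≡-Reasoning

count-split : ∀ (A S : Fin n → Bool) →
              count S ≡ count (λ i → A i ∧ S i) + count (λ i → not (A i) ∧ S i)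
count-split A S =
  trans (sumF-cong split) (sumF-distrib-+ (λ i → (A i ∧ S i) ⊙ 1) (λ i → (not (A i) ∧ S i) ⊙ 1))
  where
  split : ∀ i → S i ⊙ 1 ≡ (A i ∧ S i) ⊙ 1 + (not (A i) ∧ S i) ⊙ 1
  split i with A i
  ... | true  = sym (+-identityʳ (S i ⊙ 1))
  ... | false = refl

∃-≤-average : ∀ (P : Fin n → Bool) (a : Fin n → ℕ) x → 0 < count P →
              sumF (λ v → P v ⊙ a v) ≤ count P * x → ∃ λ v → P v ≡ true × a v ≤ x
∃-≤-average P a x 0<|P| avg with any? (λ v → (P v ≟ᵇ true) ×-dec (a v ≤? x))
... | yes found = found
... | no  none  = contradiction avg (<⇒≱ (begin-strict
    count P * x               <⟨ *-monoʳ-< (count P) {{>-nonZero 0<|P|}} (n<1+n x) ⟩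
    count P * suc x           ≡⟨ sumF-⊙-const P (suc x) ⟨
    sumF (λ v → P v ⊙ suc x)  ≤⟨ sumF-mono-≤ above ⟩
    sumF (λ v → P v ⊙ a v)    ∎))
  where
  open ≤-Reasoning
  above : ∀ v → P v ⊙ suc x ≤ P v ⊙ a v
  above v with P v in Pv
  ... | true  = ≰⇒> (λ av≤x → none (v , Pv , av≤x))
  ... | false = z≤n

module _ (G : Graph n) where

  nbrsIn-mono-⊆ : ∀ {S S′ : Fin n → Bool} u → S ⊆ S′ → nbrsIn G S u ≤ nbrsIn G S′ u
  nbrsIn-mono-⊆ {S} {S′} u S⊆S′ =
    count-mono-⊆ {P = λ w → adj G u w ∧ S w} {Q = λ w → adj G u w ∧ S′ w} adjacent
    where
    adjacent : ∀ w → adj G u w ∧ S w ≡ true → adj G u w ∧ S′ w ≡ true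
    adjacent w with adj G u w
    ... | true  = S⊆S′ w
    ... | false = λ ()

  nbrsIn-as-sumF : ∀ S u → nbrsIn G S u ≡ sumF (λ w → S w ⊙ adj G u w ⊙ 1)
  nbrsIn-as-sumF S u = sumF-cong (λ w → ⊙-∧ (adj G u w) (S w) 1)

  nbrsIn-remove : ∀ {R : Fin n → Bool} {v} u → R v ≡ true →
                  nbrsIn G R u ≡ adj G u v ⊙ 1 + nbrsIn G (R ─ v) u
  nbrsIn-remove {R} {v} u Rv = begin
    nbrsIn G R u
      ≡⟨ nbrsIn-as-sumF R u ⟩
    sumF (λ w → R w ⊙ adj G u w ⊙ 1)
      ≡⟨ sumF-remove {R = R} (λ w → adj G u w ⊙ 1) Rv ⟩
    adj G u v ⊙ 1 + sumF (λ w → (R ─ v) w ⊙ adj G u w ⊙ 1)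
      ≡⟨ cong (adj G u v ⊙ 1 +_) (nbrsIn-as-sumF (R ─ v) u) ⟨
    adj G u v ⊙ 1 + nbrsIn G (R ─ v) u ∎
    where open ≡-Reasoning

  nbrsIn-─ : ∀ {R : Fin n → Bool} {v} u → R v ≡ true →
             nbrsIn G (R ─ v) u ≡ (if adj G u v then pred (nbrsIn G R u) else nbrsIn G R u)
  nbrsIn-─ {R} {v} u Rv with adj G u v | nbrsIn-remove {R} {v} u Rv
  ... | true  | R≡1+R─v = cong pred (sym R≡1+R─v)
  ... | false | R≡R─v   = sym R≡R─v

  nbrsIn-─-self : ∀ {R : Fin n → Bool} u → R u ≡ true → nbrsIn G (R ─ u) u ≡ nbrsIn G R u
  nbrsIn-─-self {R} u Ru =
    trans (nbrsIn-─ {R} u Ru) (cong (λ a → if a then pred (nbrsIn G R u) else nbrsIn G R u) (irrefl G u))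

module _ (G : Graph n) (τ : Fin n → ℕ) where

  Activates : (Fin n → Bool) → (Fin n → Bool) → Set
  Activates M R = ∃ λ i → R ⊆ active G τ M i

  seed⊆active : ∀ M i → M ⊆ active G τ M i
  seed⊆active M zero    u Mu = Mu
  seed⊆active M (suc i) u Mu = cong (_∨ (τ u ≤ᵇ nbrsIn G (active G τ M i) u)) (seed⊆active M i u Mu)

  active-step : ∀ M i → active G τ M i ⊆ active G τ M (suc i)
  active-step M i u active-u = cong (_∨ (τ u ≤ᵇ nbrsIn G (active G τ M i) u)) active-u

  active-threshold : ∀ M i {S} v → S ⊆ active G τ M i → τ v ≤ nbrsIn G S v →
                     active G τ M (suc i) v ≡ true
  active-threshold M i v S⊆active τ≤S = begin
    active G τ M i v ∨ (τ v ≤ᵇ nbrsIn G (active G τ M i) v) ≡⟨ cong (active G τ M i v ∨_) reached ⟩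
    active G τ M i v ∨ true                                 ≡⟨ ∨-zeroʳ _ ⟩
    true                                                    ∎
    where
    open ≡-Reasoning
    reached : (τ v ≤ᵇ nbrsIn G (active G τ M i) v) ≡ true
    reached = Equivalence.to T-≡ (≤⇒≤ᵇ (≤-trans τ≤S (nbrsIn-mono-⊆ G v S⊆active)))

  active-mono-seed : ∀ {M M′} → M ⊆ M′ → ∀ i → active G τ M i ⊆ active G τ M′ i
  active-mono-seed M⊆M′ zero u = M⊆M′ u
  active-mono-seed {M} {M′} M⊆M′ (suc i) u active-u with active G τ M i u in was-active
  ... | true  = active-step M′ i u (active-mono-seed M⊆M′ i u was-active)
  ... | false = active-threshold M′ i u (active-mono-seed M⊆M′ i)
                  (≤ᵇ⇒≤ _ _ (Equivalence.from T-≡ active-u))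

  K : ℕ
  K = suc n !

  share : ℕ → ℕ
  share d = K / suc d

  suc*share : ∀ {d} → d ≤ n → suc d * share d ≡ K
  suc*share {d} d≤n = m*[n/m]≡n (∣-trans (m∣m*n (d !)) (m≤n⇒m!∣n! (s≤s d≤n)))

  -- K times the probability min(τ u, d + 1) / (d + 1) that, in a uniformly random order of a
  -- set in which u has d neighbours, fewer than τ u of them precede u.
  chance : Fin n → ℕ → ℕ
  chance u d = share d * (τ u ⊓ suc d)

  suc*chance : ∀ u {d} → d ≤ n → suc d * chance u d ≡ K * (τ u ⊓ suc d)
  suc*chance u {d} d≤n =
    trans (sym (*-assoc (suc d) (share d) (τ u ⊓ suc d))) (cong (_* (τ u ⊓ suc d)) (suc*share d≤n))

  *chance-pred : ∀ u d → d ≤ n → d * chance u (pred d) ≡ K * (τ u ⊓ d)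
  *chance-pred u zero    _   = sym (trans (cong (K *_) (⊓-zeroʳ (τ u))) (*-zeroʳ K))
  *chance-pred u (suc d) d<n = suc*chance u (<⇒≤ d<n)

  chance-step : ∀ u d → d ≤ n → (d <ᵇ τ u) ⊙ K + d * chance u (pred d) ≡ suc d * chance u d
  chance-step u d d≤n = begin
    b ⊙ K + d * chance u (pred d)
      ≡⟨ cong₂ _+_ (trans (*-⊙ K b 1) (cong (b ⊙_) (*-identityʳ K))) (sym (*chance-pred u d d≤n)) ⟨
    K * (b ⊙ 1) + K * (τ u ⊓ d)     ≡⟨ *-distribˡ-+ K (b ⊙ 1) (τ u ⊓ d) ⟨
    K * (b ⊙ 1 + τ u ⊓ d)           ≡⟨ cong (K *_) (⊓-suc (τ u) d) ⟩
    K * (τ u ⊓ suc d)               ≡⟨ suc*chance u d≤n ⟨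
    suc d * chance u d              ∎
    where
    open ≡-Reasoning
    b = (d <ᵇ τ u)

  chance-average : ∀ R u → R u ≡ true →
                   (nbrsIn G R u <ᵇ τ u) ⊙ K + sumF (λ v → (R ─ u) v ⊙ chance u (nbrsIn G (R ─ v) u))
                     ≡ count R * chance u (nbrsIn G R u)
  chance-average R u Ru = begin
    b ⊙ K + sumF (λ v → (R ─ u) v ⊙ chance u (nbrsIn G (R ─ v) u))
      ≡⟨ cong (b ⊙ K +_) (sumF-cong lose-neighbour) ⟩
    b ⊙ K + sumF (λ v → (R ─ u) v ⊙ (if adj G u v then chance u (pred d) else chance u d))
      ≡⟨ cong (b ⊙ K +_) (sumF-⊙-if (adj G u) (R ─ u) (chance u (pred d)) (chance u d)) ⟩
    b ⊙ K + (nbrsIn G (R ─ u) u * chance u (pred d) + c * chance u d)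
      ≡⟨ cong (λ m → b ⊙ K + (m * chance u (pred d) + c * chance u d)) (nbrsIn-─-self G u Ru) ⟩
    b ⊙ K + (d * chance u (pred d) + c * chance u d)
      ≡⟨ +-assoc (b ⊙ K) (d * chance u (pred d)) (c * chance u d) ⟨
    b ⊙ K + d * chance u (pred d) + c * chance u d
      ≡⟨ cong (_+ c * chance u d) (chance-step u d (count-≤ (λ v → adj G u v ∧ R v))) ⟩
    suc d * chance u d + c * chance u d
      ≡⟨ *-distribʳ-+ (chance u d) (suc d) c ⟨
    (suc d + c) * chance u d
      ≡⟨ cong (_* chance u d) |R|≡1+d+c ⟨
    count R * chance u d ∎
    where
    open ≡-Reasoning
    d = nbrsIn G R u
    b = d <ᵇ τ u
    c = count (λ v → not (adj G u v) ∧ (R ─ u) v)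
    lose-neighbour : ∀ v → (R ─ u) v ⊙ chance u (nbrsIn G (R ─ v) u)
                           ≡ (R ─ u) v ⊙ (if adj G u v then chance u (pred d) else chance u d)
    lose-neighbour v with (R ─ u) v in R-u∋v
    ... | true  = trans (cong (chance u) (nbrsIn-─ G u (─⊆ R u v R-u∋v))) (if-float (chance u) (adj G u v))
    ... | false = refl
    |R|≡1+d+c : count R ≡ suc d + c
    |R|≡1+d+c = trans (count-─ R Ru)
                  (cong suc (trans (count-split (adj G u) (R ─ u)) (cong (_+ c) (nbrsIn-─-self G u Ru))))

  weight : Fin n → ℕ
  weight u = suc (deg G u)

  cost : (Fin n → Bool) → ℕ
  cost M = sumF (λ u → M u ⊙ weight u)

  -- The weight of v when it comes last in the order of R: all its R-neighbours precede it.
  seedCost : (Fin n → Bool) → Fin n → ℕ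
  seedCost R v = (nbrsIn G R v <ᵇ τ v) ⊙ weight v

  potential : (Fin n → Bool) → ℕ
  potential R = sumF (λ u → R u ⊙ (weight u * chance u (nbrsIn G R u)))

  weighted-chance-average : ∀ R u → R u ≡ true →
    K * seedCost R u + sumF (λ v → (R ─ u) v ⊙ (weight u * chance u (nbrsIn G (R ─ v) u)))
      ≡ count R * (weight u * chance u (nbrsIn G R u))
  weighted-chance-average R u Ru = begin
    K * (b ⊙ w) + sumF (λ v → (R ─ u) v ⊙ (w * p v))
      ≡⟨ cong₂ _+_ (*-⊙ K b w) (sumF-cong (λ v → sym (*-⊙ w ((R ─ u) v) (p v)))) ⟩
    b ⊙ (K * w) + sumF (λ v → w * ((R ─ u) v ⊙ p v))
      ≡⟨ cong₂ _+_ (trans (*-⊙ w b K) (cong (b ⊙_) (*-comm w K)))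
                   (*-distribˡ-sumF w (λ v → (R ─ u) v ⊙ p v)) ⟨
    w * (b ⊙ K) + w * sumF (λ v → (R ─ u) v ⊙ p v)
      ≡⟨ *-distribˡ-+ w (b ⊙ K) (sumF (λ v → (R ─ u) v ⊙ p v)) ⟨
    w * (b ⊙ K + sumF (λ v → (R ─ u) v ⊙ p v))
      ≡⟨ cong (w *_) (chance-average R u Ru) ⟩
    w * (count R * chance u (nbrsIn G R u))
      ≡⟨ x∙yz≈y∙xz w (count R) (chance u (nbrsIn G R u)) ⟩
    count R * (w * chance u (nbrsIn G R u)) ∎
    where
    open ≡-Reasoning
    w = weight u
    b = nbrsIn G R u <ᵇ τ u
    p : Fin n → ℕ
    p v = chance u (nbrsIn G (R ─ v) u)

  potential-average : ∀ R → sumF (λ v → R v ⊙ (K * seedCost R v + potential (R ─ v))) ≡ count R * potential R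
  potential-average R = begin
    sumF (λ v → R v ⊙ (K * seedCost R v + potential (R ─ v)))
      ≡⟨ sumF-cong (λ v → ⊙-distrib-+ (R v) (K * seedCost R v) (potential (R ─ v))) ⟩
    sumF (λ v → R v ⊙ (K * seedCost R v) + R v ⊙ potential (R ─ v))
      ≡⟨ sumF-distrib-+ (λ v → R v ⊙ (K * seedCost R v)) (λ v → R v ⊙ potential (R ─ v)) ⟩
    sumF (λ u → R u ⊙ (K * seedCost R u)) + sumF (λ v → R v ⊙ potential (R ─ v))
      ≡⟨ cong (sumF (λ u → R u ⊙ (K * seedCost R u)) +_)
              (trans (sumF-cong (λ v → ⊙-sumF (R v) (Z v))) (sumF-comm X)) ⟩
    sumF (λ u → R u ⊙ (K * seedCost R u)) + sumF (λ u → sumF (λ v → X v u))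
      ≡⟨ sumF-distrib-+ (λ u → R u ⊙ (K * seedCost R u)) (λ u → sumF (λ v → X v u)) ⟨
    sumF (λ u → R u ⊙ (K * seedCost R u) + sumF (λ v → X v u))
      ≡⟨ sumF-cong averaged-at ⟩
    sumF (λ u → count R * (R u ⊙ (weight u * chance u (nbrsIn G R u))))
      ≡⟨ *-distribˡ-sumF (count R) (λ u → R u ⊙ (weight u * chance u (nbrsIn G R u))) ⟨
    count R * potential R ∎
    where
    open ≡-Reasoning
    Z X : Fin n → Fin n → ℕ
    Z v u = (R ─ v) u ⊙ (weight u * chance u (nbrsIn G (R ─ v) u))
    X v u = R v ⊙ Z v u
    Y : Fin n → Fin n → ℕ
    Y u v = (R ─ u) v ⊙ (weight u * chance u (nbrsIn G (R ─ v) u))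
    member : ∀ u → R u ⊙ (K * seedCost R u + sumF (Y u)) ≡ count R * (R u ⊙ (weight u * chance u (nbrsIn G R u)))
    member u with R u in Ru
    ... | true  = weighted-chance-average R u Ru
    ... | false = sym (*-zeroʳ (count R))
    averaged-at : ∀ u → R u ⊙ (K * seedCost R u) + sumF (λ v → X v u)
                        ≡ count R * (R u ⊙ (weight u * chance u (nbrsIn G R u)))
    averaged-at u = begin
      R u ⊙ (K * seedCost R u) + sumF (λ v → X v u)
        ≡⟨ cong (R u ⊙ (K * seedCost R u) +_)
                (trans (sumF-cong (λ v → ∈─-comm R u v _)) (sym (⊙-sumF (R u) (Y u)))) ⟩
      R u ⊙ (K * seedCost R u) + R u ⊙ sumF (Y u)
        ≡⟨ ⊙-distrib-+ (R u) (K * seedCost R u) (sumF (Y u)) ⟨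
      R u ⊙ (K * seedCost R u + sumF (Y u))
        ≡⟨ member u ⟩
      count R * (R u ⊙ (weight u * chance u (nbrsIn G R u))) ∎

  seed-or-activate : ∀ {R M} v → R v ≡ true → Activates M (R ─ v) →
                     ∃ λ M′ → Activates M′ R × cost M′ ≤ cost M + (nbrsIn G R v <ᵇ τ v) ⊙ weight v
  seed-or-activate {R} {M} v Rv (i , R-v⊆active)
    with nbrsIn G R v <ᵇ τ v | <ᵇ-reflects-< (nbrsIn G R v) (τ v)
  ... | true  | _        = M ∪｛ v ｝ , (i , seeded) , sumF-∪-≤ M v weight
    where
    seeded : R ⊆ active G τ (M ∪｛ v ｝) i
    seeded u Ru with ∈⇒≡⊎∈─ R u v Ru
    ... | inj₁ refl   = seed⊆active (M ∪｛ u ｝) i u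
                          (trans (cong (M u ∨_) (dec-true (u ≟ u) refl)) (∨-zeroʳ (M u)))
    ... | inj₂ R-v∋u = active-mono-seed (λ w Mw → cong (_∨ does (w ≟ v)) Mw) i u (R-v⊆active u R-v∋u)
  ... | false | ofⁿ d≮τ = M , (suc i , activated) , m≤m+n (cost M) 0
    where
    activated : R ⊆ active G τ M (suc i)
    activated u Ru with ∈⇒≡⊎∈─ R u v Ru
    ... | inj₁ refl   = active-threshold M i u R-v⊆active
                          (subst (τ u ≤_) (sym (nbrsIn-─-self G u Ru)) (≮⇒≥ d≮τ))
    ... | inj₂ R-v∋u = active-step M i u (R-v⊆active u R-v∋u)

  cheap-seed : ∀ k R → count R ≡ k → ∃ λ M → Activates M R × K * cost M ≤ potential R
  cheap-seed zero R |R|≡0 =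
    (λ _ → false) , (0 , λ u Ru → contradiction (trans (sym (count-─ R Ru)) |R|≡0) 1+n≢0) ,
    ≤-trans (≤-reflexive (trans (cong (K *_) (sumF-zero {n})) (*-zeroʳ K))) z≤n
  cheap-seed (suc k) R |R|≡1+k
    with ∃-≤-average R (λ v → K * seedCost R v + potential (R ─ v)) (potential R)
                     (subst (0 <_) (sym |R|≡1+k) z<s) (≤-reflexive (potential-average R))
  ... | v , Rv , below-average
    with cheap-seed k (R ─ v) (suc-injective (trans (sym (count-─ R Rv)) |R|≡1+k))
  ... | M , activates , K*cost≤
    with seed-or-activate v Rv activates
  ... | M′ , activates′ , cost≤ = M′ , activates′ , (begin
    K * cost M′                          ≤⟨ *-monoʳ-≤ K cost≤ ⟩
    K * (cost M + seedCost R v)          ≡⟨ *-distribˡ-+ K (cost M) (seedCost R v) ⟩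
    K * cost M + K * seedCost R v        ≤⟨ +-monoˡ-≤ (K * seedCost R v) K*cost≤ ⟩
    potential (R ─ v) + K * seedCost R v ≡⟨ +-comm (potential (R ─ v)) (K * seedCost R v) ⟩
    K * seedCost R v + potential (R ─ v) ≤⟨ below-average ⟩
    potential R                          ∎)
    where open ≤-Reasoning

  potential-full : IsThreshold G τ → potential (λ _ → true) ≡ K * sumF τ
  potential-full τ≤deg = trans (sumF-cong full) (sym (*-distribˡ-sumF K τ))
    where
    full : ∀ u → weight u * chance u (nbrsIn G (λ _ → true) u) ≡ K * τ u
    full u = begin
      weight u * chance u (nbrsIn G (λ _ → true) u)
        ≡⟨ cong (λ d → weight u * chance u d) (sumF-cong (λ w → cong (_⊙ 1) (∧-identityʳ (adj G u w)))) ⟩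
      suc (deg G u) * chance u (deg G u)
        ≡⟨ suc*chance u (count-≤ (adj G u)) ⟩
      K * (τ u ⊓ suc (deg G u))
        ≡⟨ cong (K *_) (m≤n⇒m⊓n≡m (m≤n⇒m≤1+n (τ≤deg u))) ⟩
      K * τ u ∎
      where open ≡-Reasoning

prefix-shift : ∀ d k → prefix d (suc k) ≡ (d 0 + 1) + prefix (λ i → d (suc i)) k
prefix-shift d zero    = sym (+-identityʳ (d 0 + 1))
prefix-shift d (suc k) = trans (cong (_+ (d (suc k) + 1)) (prefix-shift d k)) (+-assoc (d 0 + 1) _ _)

prefix-mono-≤ : ∀ {d d′} k → (∀ i → i < k → d i ≤ d′ i) → prefix d k ≤ prefix d′ k
prefix-mono-≤ zero    d≤d′ = z≤n
prefix-mono-≤ (suc k) d≤d′ =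
  +-mono-≤ (prefix-mono-≤ k (λ i i<k → d≤d′ i (m<n⇒m<1+n i<k))) (+-monoˡ-≤ 1 (d≤d′ k (n<1+n k)))

prefix≤subsetSum : ∀ {m} (d : ℕ → ℕ) → (∀ i → suc i < m → d i ≤ d (suc i)) → (P : Fin m → Bool) →
                   prefix d (count P) ≤ sumF (λ i → P i ⊙ (d (toℕ i) + 1))
prefix≤subsetSum {zero}  d sorted P = z≤n
prefix≤subsetSum {suc m} d sorted P
  with P zero
     | prefix≤subsetSum (λ i → d (suc i)) (λ i 2+i<1+m → sorted (suc i) (s≤s 2+i<1+m)) (λ i → P (suc i))
... | true  | ih = ≤-trans (≤-reflexive (prefix-shift d |P′|)) (+-monoʳ-≤ (d 0 + 1) ih)
  where |P′| = count (λ i → P (suc i))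
... | false | ih = ≤-trans (prefix-mono-≤ |P′| sorted-below) ih
  where
  P′ = λ i → P (suc i)
  |P′| = count P′
  sorted-below : ∀ i → i < |P′| → d i ≤ d (suc i)
  sorted-below i i<|P′| = sorted i (s≤s (≤-trans i<|P′| (count-≤ P′)))

≤-maxSat : ∀ P m k → k ≤ m → P k ≡ true → k ≤ maxSat P m
≤-maxSat P zero    _ z≤n   _  = z≤n
≤-maxSat P (suc m) k k≤1+m Pk with P (suc m) in P[1+m]
... | true  = k≤1+m
... | false with m≤n⇒m<n∨m≡n k≤1+m
...   | inj₁ k<1+m = ≤-maxSat P m k (s≤s⁻¹ k<1+m) Pk
...   | inj₂ refl  = contradiction (trans (sym Pk) P[1+m]) λ ()

module _ (G : Graph n) (σ : Permutation′ n) where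

  degSeq-fromℕ< : ∀ {k} (k<n : k < n) → degSeq G σ k ≡ deg G (σ ⟨$⟩ʳ fromℕ< k<n)
  degSeq-fromℕ< {k} k<n with k <? n
  ... | yes k<n′ = cong (λ i → deg G (σ ⟨$⟩ʳ i)) (fromℕ<-cong k k refl k<n′ k<n)
  ... | no  k≮n  = contradiction k<n k≮n

  degSeq-toℕ : ∀ i → degSeq G σ (toℕ i) ≡ deg G (σ ⟨$⟩ʳ i)
  degSeq-toℕ i =
    trans (degSeq-fromℕ< (toℕ<n i)) (cong (λ j → deg G (σ ⟨$⟩ʳ j)) (fromℕ<-toℕ i (toℕ<n i)))

  degSeq-sorted : Sorts G σ → ∀ i → suc i < n → degSeq G σ i ≤ degSeq G σ (suc i)
  degSeq-sorted sorts i 1+i<n = begin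
    degSeq G σ i                       ≡⟨ degSeq-fromℕ< i<n ⟩
    deg G (σ ⟨$⟩ʳ fromℕ< i<n)          ≤⟨ sorts _ _ fromℕ<-mono ⟩
    deg G (σ ⟨$⟩ʳ fromℕ< 1+i<n)        ≡⟨ degSeq-fromℕ< 1+i<n ⟨
    degSeq G σ (suc i)                 ∎
    where
    open ≤-Reasoning
    i<n : i < n
    i<n = <-trans (n<1+n i) 1+i<n
    fromℕ<-mono : fromℕ< i<n ≤F fromℕ< 1+i<n
    fromℕ<-mono = subst₂ _≤_ (sym (toℕ-fromℕ< i<n)) (sym (toℕ-fromℕ< 1+i<n)) (n≤1+n i)

  prefix-degSeq≤cost : Sorts G σ → ∀ M → prefix (degSeq G σ) (count M) ≤ sumF (λ u → M u ⊙ suc (deg G u))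
  prefix-degSeq≤cost sorts M = begin
    prefix (degSeq G σ) (count M)
      ≡⟨ cong (prefix (degSeq G σ)) (sumF-permute (λ u → M u ⊙ 1) σ) ⟩
    prefix (degSeq G σ) (count (λ i → M (σ ⟨$⟩ʳ i)))
      ≤⟨ prefix≤subsetSum (degSeq G σ) (degSeq-sorted sorts) (λ i → M (σ ⟨$⟩ʳ i)) ⟩
    sumF (λ i → M (σ ⟨$⟩ʳ i) ⊙ (degSeq G σ (toℕ i) + 1))
      ≡⟨ sumF-cong (λ i → cong (M (σ ⟨$⟩ʳ i) ⊙_) (trans (cong (_+ 1) (degSeq-toℕ i)) (+-comm _ 1))) ⟩
    sumF (λ i → M (σ ⟨$⟩ʳ i) ⊙ suc (deg G (σ ⟨$⟩ʳ i)))
      ≡⟨ sumF-permute (λ u → M u ⊙ suc (deg G u)) σ ⟨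
    sumF (λ u → M u ⊙ suc (deg G u)) ∎
    where open ≤-Reasoning

theorem5 : (n : ℕ) (G : Graph n) (σ : Permutation′ n) → Sorts G σ →
           (τ : Fin n → ℕ) → IsThreshold G τ →
           DynLe G τ (bound (degSeq G σ) n (sumF τ))
theorem5 n G σ sorts τ τ≤deg with cheap-seed G τ _ (λ _ → true) refl
... | M , (i , all⊆active) , K*cost≤ = M , (λ v → i , all⊆active v refl) , count≤bound
  where
  cost≤Στ : cost G τ M ≤ sumF τ
  cost≤Στ = *-cancelˡ-≤ (K G τ) {{suc n !≢0}}
              (subst (K G τ * cost G τ M ≤_) (potential-full G τ τ≤deg) K*cost≤)
  count≤bound : count M ≤ bound (degSeq G σ) n (sumF τ)
  count≤bound = ≤-maxSat _ n (count M) (count-≤ M)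
                  (Equivalence.to T-≡ (≤⇒≤ᵇ (≤-trans (prefix-degSeq≤cost G σ sorts M) cost≤Στ)))
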